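{- Let $D=(V,A)$ be a digraph with minimum dicut size $\tau$, and let $k\ge 2$ be a rational number. If the underlying undirected graph of $D$ admits a nowhere-zero circular $k$-flow, then $D$ contains two arc-disjoint $\lfloor \tau/k\rfloor$-dijoins.
   Context: For $U\subseteq V$, $\delta^+_D(U)$ and $\delta^-_D(U)$ denote the arcs leaving and entering $U$. A dicut is an arc set $\delta^+_D(U)$ with $\emptyset\neq U\subsetneq V$ and $\delta^-_D(U)=\emptyset$; the minimum dicut size is the minimum cardinality of a dicut. For an integer $t$, a $t$-dijoin is an arc set $J\subseteq A$ with $|J\cap C|\ge t$ for every dicut $C$. The underlying undirected graph replaces each arc $(u,v)$ by an edge $\{u,v\}$. For an undirected (multi)graph $G=(V,E)$, a nowhere-zero circular $k$-flow is an orientation $E^+$ of $E$ and a function $f:E^+\to[1,k-1]$ with flow conservation $\sum_{e\in\delta^+_{E^+}(v)}f(e)=\sum_{e\in\delta^-_{E^+}(v)}f(e)$ at every vertex $v$.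
   Formalization: The nowhere-zero circular $k$-flow on the underlying undirected graph takes only rational values in $[1,k-1]$. -}

module Defs where

open import Data.Nat using (ℕ; zero; suc)
open import Data.Fin using (Fin; zero; suc)
open import Data.Bool using (Bool; true; false; if_then_else_; _∧_; not)
open import Data.Product using (_×_; _,_; ∃; proj₁; proj₂)
open import Data.Integer using (ℤ; +_)
import Data.Integer as ℤ
open import Data.Rational using (ℚ; 0ℚ; 1ℚ; _≤_; _<_; _-_; _÷_; floor; _/_)
import Data.Rational as ℚ
open import Data.Rational.Properties using (<-≤-trans)
open import Relation.Binary.PropositionalEquality using (_≡_)

record Digraph : Set where
  field
    n    : ℕ
    m    : ℕ
    tail : Fin m → Fin n
    head : Fin m → Fin n
open Digraph public

record Graph : Set where
  field
    nV   : ℕ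
    nE   : ℕ
    end₁ : Fin nE → Fin nV
    end₂ : Fin nE → Fin nV
open Graph public

underlying : Digraph → Graph
underlying D = record { nV = n D ; nE = m D ; end₁ = tail D ; end₂ = head D }

VSet : Digraph → Set
VSet D = Fin (n D) → Bool

ASet : Digraph → Set
ASet D = Fin (m D) → Bool

count : ∀ {m} → (Fin m → Bool) → ℕ
count {zero}  P = 0
count {suc m} P = (if P zero then 1 else 0) Data.Nat.+ count (λ i → P (suc i))

δ⁺ : (D : Digraph) → VSet D → ASet D
δ⁺ D U a = U (tail D a) ∧ not (U (head D a))

δ⁻ : (D : Digraph) → VSet D → ASet D
δ⁻ D U a = not (U (tail D a)) ∧ U (head D a)

IsDicutShore : (D : Digraph) → VSet D → Set
IsDicutShore D U =
  (∃ λ v → U v ≡ true) × (∃ λ v → U v ≡ false) × (∀ a → δ⁻ D U a ≡ false)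

IsDicut : (D : Digraph) → ASet D → Set
IsDicut D C = ∃ λ U → IsDicutShore D U × (∀ a → C a ≡ δ⁺ D U a)

IsMinDicutSize : Digraph → ℕ → Set
IsMinDicutSize D τ =
  (∃ λ C → IsDicut D C × count C ≡ τ) × (∀ C → IsDicut D C → τ Data.Nat.≤ count C)

IsDijoin : (D : Digraph) → ℤ → ASet D → Set
IsDijoin D t J = ∀ C → IsDicut D C → t ℤ.≤ + count (λ a → J a ∧ C a)

Disjoint : (D : Digraph) → ASet D → ASet D → Set
Disjoint D J₁ J₂ = ∀ a → J₁ a ∧ J₂ a ≡ false

sumℚ : ∀ {m} → (Fin m → ℚ) → ℚ
sumℚ {zero}  f = 0ℚ
sumℚ {suc m} f = f zero ℚ.+ sumℚ (λ i → f (suc i))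

-- An orientation chooses for every edge e whether it is oriented end₁ → end₂ (false)
-- or end₂ → end₁ (true).
Orientation : Graph → Set
Orientation G = Fin (nE G) → Bool

otail : (G : Graph) → Orientation G → Fin (nE G) → Fin (nV G)
otail G o e = if o e then end₂ G e else end₁ G e

ohead : (G : Graph) → Orientation G → Fin (nE G) → Fin (nV G)
ohead G o e = if o e then end₁ G e else end₂ G e

_==_ : ∀ {n} → Fin n → Fin n → Bool
zero  == zero  = true
zero  == suc _ = false
suc _ == zero  = false
suc i == suc j = i == j

NZCircularFlow : Graph → ℚ → Set
NZCircularFlow G k =
  ∃ λ (o : Orientation G) → ∃ λ (f : Fin (nE G) → ℚ) →
    (∀ e → (1ℚ ≤ f e) × (f e ≤ k - 1ℚ)) ×
    (∀ v → sumℚ (λ e → if otail G o e == v then f e else 0ℚ)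
         ≡ sumℚ (λ e → if ohead G o e == v then f e else 0ℚ))

0<2 : 0ℚ < (+ 2) / 1
0<2 = ℚ.*<* (ℤ.+<+ (Data.Nat.s≤s Data.Nat.z≤n))

floorDiv : ℕ → (k : ℚ) → (+ 2) / 1 ≤ k → ℤ
floorDiv τ k 2≤k = floor (_÷_ ((+ τ) / 1) k {{ℚ.>-nonZero (<-≤-trans 0<2 2≤k)}})

-- Orient the arcs of D as the flow does. For a dicut δ⁺(U), summing flow conservation over U
-- shows that the flow leaving U equals the flow entering U. An arc of the dicut that the flow
-- traverses forwards carries at most k − 1 out of U, one traversed backwards at least 1 into U;
-- so #backward ≤ (k − 1)·#forward, i.e. #forward ≥ |δ⁺(U)|/k ≥ τ/k. Reversing the flow swaps
-- the two classes, so the forward arcs and the backward arcs are two disjoint ⌊τ/k⌋-dijoins.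
module Submission where

open import Algebra.Bundles using (CommutativeMonoid)
import Algebra.Properties.CommutativeSemigroup as CommSemigroupProperties
import Algebra.Properties.Group as GroupProperties
open import Data.Bool using (Bool; true; false; if_then_else_; _∧_; not)
open import Data.Bool.Properties using (∧-comm; ∧-inverseʳ; if-not)
open import Data.Fin using (Fin; zero; suc)
open import Data.Integer using (ℤ; +_)
import Data.Integer as ℤ
open import Data.Integer.DivMod using ([n/d]*d≤n)
import Data.Integer.Properties as ℤ
open import Data.Nat using (ℕ; zero; suc)
import Data.Nat as ℕ
import Data.Nat.Properties as ℕ
open import Data.Product using (_×_; _,_; ∃; proj₁; proj₂)
open import Data.Rational using (ℚ; mkℚ; 0ℚ; 1ℚ; _≤_; _/_; _-_; _÷_; floor; ↥_; ↧_; Positive)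
import Data.Rational as ℚ
open import Data.Rational.Literals using (fromℤ)
import Data.Rational.Properties as ℚ
import Data.Rational.Solver as ℚSolver
open import Relation.Binary.PropositionalEquality

open import Defs

fromℕ : ℕ → ℚ
fromℕ n = + n / 1

fromℕ-suc : ∀ n → fromℕ (suc n) ≡ 1ℚ ℚ.+ fromℕ n
fromℕ-suc zero    = refl
fromℕ-suc n@(suc m) = begin
  + suc n / 1                 ≡⟨ cong (λ j → + suc (suc j) / 1) (ℕ.*-identityʳ m) ⟨
  1ℚ ℚ.+ fromℤ (+ n)          ≡⟨ cong (1ℚ ℚ.+_) (ℚ.↥p/↧p≡p (fromℤ (+ n))) ⟨
  1ℚ ℚ.+ fromℕ n              ∎
  where open ≡-Reasoning

fromℕ-+ : ∀ m n → fromℕ (m ℕ.+ n) ≡ fromℕ m ℚ.+ fromℕ n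
fromℕ-+ zero    n = sym (ℚ.+-identityˡ (fromℕ n))
fromℕ-+ (suc m) n = begin
  fromℕ (suc (m ℕ.+ n))            ≡⟨ fromℕ-suc (m ℕ.+ n) ⟩
  1ℚ ℚ.+ fromℕ (m ℕ.+ n)           ≡⟨ cong (1ℚ ℚ.+_) (fromℕ-+ m n) ⟩
  1ℚ ℚ.+ (fromℕ m ℚ.+ fromℕ n)     ≡⟨ ℚ.+-assoc 1ℚ (fromℕ m) (fromℕ n) ⟨
  (1ℚ ℚ.+ fromℕ m) ℚ.+ fromℕ n     ≡⟨ cong (ℚ._+ fromℕ n) (fromℕ-suc m) ⟨
  fromℕ (suc m) ℚ.+ fromℕ n        ∎
  where open ≡-Reasoning

fromℕ-mono-≤ : ∀ {m n} → m ℕ.≤ n → fromℕ m ≤ fromℕ n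
fromℕ-mono-≤ {m} {n} m≤n = subst₂ _≤_ (sym (ℚ.↥p/↧p≡p (fromℤ (+ m)))) (sym (ℚ.↥p/↧p≡p (fromℤ (+ n))))
  (ℚ.*≤* (ℤ.*-monoʳ-≤-nonNeg (+ 1) (ℤ.+≤+ m≤n)))

floor-≤ : ∀ {q : ℚ} {i : ℤ} → q ≤ i / 1 → floor q ℤ.≤ i
floor-≤ {q@(mkℚ _ _ _)} {i} q≤i = ℤ.*-cancelʳ-≤-pos (floor q) i (↧ q) (begin
  floor q ℤ.* ↧ q   ≤⟨ [n/d]*d≤n (↥ q) (↧ q) ⟩
  ↥ q               ≡⟨ ℤ.*-identityʳ (↥ q) ⟨
  ↥ q ℤ.* + 1       ≤⟨ ℚ.drop-*≤* (subst (q ≤_) (ℚ.↥p/↧p≡p (fromℤ i)) q≤i) ⟩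
  i ℤ.* ↧ q         ∎)
  where open ℤ.≤-Reasoning

÷-≤ : ∀ {p q} k .{{_ : Positive k}} → p ≤ k ℚ.* q → (p ÷ k) {{ℚ.pos⇒nonZero k}} ≤ q
÷-≤ {p} {q} k p≤kq = ℚ.*-cancelʳ-≤-pos k (begin
  (p ÷ k) ℚ.* k        ≡⟨ ℚ.*-assoc p (ℚ.1/ k) k ⟩
  p ℚ.* (ℚ.1/ k ℚ.* k) ≡⟨ cong (p ℚ.*_) (ℚ.*-inverseˡ k) ⟩
  p ℚ.* 1ℚ             ≡⟨ ℚ.*-identityʳ p ⟩
  p                    ≤⟨ p≤kq ⟩
  k ℚ.* q              ≡⟨ ℚ.*-comm k q ⟩
  q ℚ.* k              ∎)
  where
  open ℚ.≤-Reasoning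
  instance
    k-nonZero : ℚ.NonZero k
    k-nonZero = ℚ.pos⇒nonZero k

𝟙[_]_ : Bool → ℚ → ℚ
𝟙[ b ] x = if b then x else 0ℚ

𝟙-mono-≤ : ∀ b {x y} → x ≤ y → 𝟙[ b ] x ≤ 𝟙[ b ] y
𝟙-mono-≤ true  x≤y = x≤y
𝟙-mono-≤ false _   = ℚ.≤-refl

𝟙-0 : ∀ b → 𝟙[ b ] 0ℚ ≡ 0ℚ
𝟙-0 true  = refl
𝟙-0 false = refl

sumℚ-cong : ∀ {m} {f g : Fin m → ℚ} → (∀ i → f i ≡ g i) → sumℚ f ≡ sumℚ g
sumℚ-cong {zero}  f≡g = refl
sumℚ-cong {suc m} f≡g = cong₂ ℚ._+_ (f≡g zero) (sumℚ-cong (λ i → f≡g (suc i)))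

sumℚ-mono-≤ : ∀ {m} {f g : Fin m → ℚ} → (∀ i → f i ≤ g i) → sumℚ f ≤ sumℚ g
sumℚ-mono-≤ {zero}  f≤g = ℚ.≤-refl
sumℚ-mono-≤ {suc m} f≤g = ℚ.+-mono-≤ (f≤g zero) (sumℚ-mono-≤ (λ i → f≤g (suc i)))

sumℚ-0 : ∀ m → sumℚ {m} (λ _ → 0ℚ) ≡ 0ℚ
sumℚ-0 zero    = refl
sumℚ-0 (suc m) = trans (ℚ.+-identityˡ _) (sumℚ-0 m)

sumℚ-distrib-+ : ∀ {m} (f g : Fin m → ℚ) → sumℚ (λ i → f i ℚ.+ g i) ≡ sumℚ f ℚ.+ sumℚ g
sumℚ-distrib-+ {zero}  f g = sym (ℚ.+-identityˡ 0ℚ)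
sumℚ-distrib-+ {suc m} f g = begin
  (f zero ℚ.+ g zero) ℚ.+ sumℚ (λ i → f (suc i) ℚ.+ g (suc i))
    ≡⟨ cong ((f zero ℚ.+ g zero) ℚ.+_) (sumℚ-distrib-+ (λ i → f (suc i)) (λ i → g (suc i))) ⟩
  (f zero ℚ.+ g zero) ℚ.+ (sumℚ (λ i → f (suc i)) ℚ.+ sumℚ (λ i → g (suc i)))
    ≡⟨ +-interchange (f zero) (g zero) _ _ ⟩
  (f zero ℚ.+ sumℚ (λ i → f (suc i))) ℚ.+ (g zero ℚ.+ sumℚ (λ i → g (suc i))) ∎
  where
  open ≡-Reasoning
  open CommSemigroupProperties (CommutativeMonoid.commutativeSemigroup ℚ.+-0-commutativeMonoid)
    renaming (interchange to +-interchange)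

sumℚ-comm : ∀ n m (h : Fin n → Fin m → ℚ) →
  sumℚ (λ v → sumℚ (λ e → h v e)) ≡ sumℚ (λ e → sumℚ (λ v → h v e))
sumℚ-comm zero    m h = sym (sumℚ-0 m)
sumℚ-comm (suc n) m h = trans (cong (sumℚ (h zero) ℚ.+_) (sumℚ-comm n m (λ v → h (suc v))))
  (sym (sumℚ-distrib-+ (h zero) (λ e → sumℚ (λ v → h (suc v) e))))

𝟙-sumℚ : ∀ {m} b (g : Fin m → ℚ) → 𝟙[ b ] sumℚ g ≡ sumℚ (λ i → 𝟙[ b ] g i)
𝟙-sumℚ true  g = refl
𝟙-sumℚ {m} false g = sym (sumℚ-0 m)

sumℚ-𝟙-== : ∀ {n} (w : Fin n) (P : Fin n → Bool) x →
  sumℚ (λ v → 𝟙[ P v ] 𝟙[ w == v ] x) ≡ 𝟙[ P w ] x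
sumℚ-𝟙-== {suc n} zero P x = begin
  𝟙[ P zero ] x ℚ.+ sumℚ (λ v → 𝟙[ P (suc v) ] 0ℚ) ≡⟨ cong (𝟙[ P zero ] x ℚ.+_) (trans (sumℚ-cong (λ v → 𝟙-0 (P (suc v)))) (sumℚ-0 n)) ⟩
  𝟙[ P zero ] x ℚ.+ 0ℚ                             ≡⟨ ℚ.+-identityʳ _ ⟩
  𝟙[ P zero ] x                                    ∎
  where open ≡-Reasoning
sumℚ-𝟙-== {suc n} (suc w) P x = begin
  𝟙[ P zero ] 0ℚ ℚ.+ sumℚ (λ v → 𝟙[ P (suc v) ] 𝟙[ w == v ] x) ≡⟨ cong (ℚ._+ sumℚ (λ v → 𝟙[ P (suc v) ] 𝟙[ w == v ] x)) (𝟙-0 (P zero)) ⟩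
  0ℚ ℚ.+ sumℚ (λ v → 𝟙[ P (suc v) ] 𝟙[ w == v ] x)             ≡⟨ ℚ.+-identityˡ _ ⟩
  sumℚ (λ v → 𝟙[ P (suc v) ] 𝟙[ w == v ] x)                    ≡⟨ sumℚ-𝟙-== w (λ v → P (suc v)) x ⟩
  𝟙[ P (suc w) ] x                                            ∎
  where open ≡-Reasoning

sumℚ-fibres : ∀ {n m} (U : Fin n → Bool) (t : Fin m → Fin n) (f : Fin m → ℚ) →
  sumℚ (λ v → 𝟙[ U v ] sumℚ (λ e → 𝟙[ t e == v ] f e)) ≡ sumℚ (λ e → 𝟙[ U (t e) ] f e)
sumℚ-fibres {n} {m} U t f = begin
  sumℚ (λ v → 𝟙[ U v ] sumℚ (λ e → 𝟙[ t e == v ] f e)) ≡⟨ sumℚ-cong (λ v → 𝟙-sumℚ (U v) (λ e → 𝟙[ t e == v ] f e)) ⟩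
  sumℚ (λ v → sumℚ (λ e → 𝟙[ U v ] 𝟙[ t e == v ] f e)) ≡⟨ sumℚ-comm n m _ ⟩
  sumℚ (λ e → sumℚ (λ v → 𝟙[ U v ] 𝟙[ t e == v ] f e)) ≡⟨ sumℚ-cong (λ e → sumℚ-𝟙-== (t e) U (f e)) ⟩
  sumℚ (λ e → 𝟙[ U (t e) ] f e)                         ∎
  where open ≡-Reasoning

sumℚ-𝟙-count : ∀ {m} (P : Fin m → Bool) c → sumℚ (λ i → 𝟙[ P i ] c) ≡ c ℚ.* fromℕ (count P)
sumℚ-𝟙-count {zero}  P c = sym (ℚ.*-zeroʳ c)
sumℚ-𝟙-count {suc m} P c with P zero
... | true  = begin
  c ℚ.+ sumℚ (λ i → 𝟙[ P (suc i) ] c)     ≡⟨ cong (c ℚ.+_) (sumℚ-𝟙-count (λ i → P (suc i)) c) ⟩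
  c ℚ.+ c ℚ.* fromℕ r                     ≡⟨ cong (ℚ._+ c ℚ.* fromℕ r) (ℚ.*-identityʳ c) ⟨
  c ℚ.* 1ℚ ℚ.+ c ℚ.* fromℕ r              ≡⟨ ℚ.*-distribˡ-+ c 1ℚ (fromℕ r) ⟨
  c ℚ.* (1ℚ ℚ.+ fromℕ r)                  ≡⟨ cong (c ℚ.*_) (fromℕ-suc r) ⟨
  c ℚ.* fromℕ (suc r)                     ∎
  where
  open ≡-Reasoning
  r : ℕ
  r = count (λ i → P (suc i))
... | false = trans (ℚ.+-identityˡ _) (sumℚ-𝟙-count (λ i → P (suc i)) c)

count-cong : ∀ {m} {P Q : Fin m → Bool} → (∀ i → P i ≡ Q i) → count P ≡ count Q
count-cong {zero}  P≡Q = refl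
count-cong {suc m} P≡Q = cong₂ ℕ._+_ (cong (λ b → if b then 1 else 0) (P≡Q zero)) (count-cong (λ i → P≡Q (suc i)))

count-split : ∀ {m} (P Q : Fin m → Bool) →
  count Q ≡ count (λ i → not (P i) ∧ Q i) ℕ.+ count (λ i → P i ∧ Q i)
count-split {zero}  P Q = refl
count-split {suc m} P Q with P zero | Q zero | count-split (λ i → P (suc i)) (λ i → Q (suc i))
... | false | true  | ih = cong suc ih
... | false | false | ih = ih
... | true  | true  | ih = trans (cong suc ih) (sym (ℕ.+-suc _ _))
... | true  | false | ih = ih

IsCirculation : (G : Graph) → Orientation G → (Fin (nE G) → ℚ) → Set
IsCirculation G o f =
  ∀ v → sumℚ (λ e → 𝟙[ otail G o e == v ] f e) ≡ sumℚ (λ e → 𝟙[ ohead G o e == v ] f e)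

reverse : ∀ {m} → (Fin m → Bool) → Fin m → Bool
reverse o e = not (o e)

circulation-reverse : ∀ {G o f} → IsCirculation G o f → IsCirculation G (reverse o) f
circulation-reverse {G} {o} {f} conserved v = begin
  sumℚ (λ e → 𝟙[ otail G (reverse o) e == v ] f e) ≡⟨ sumℚ-cong (λ e → cong (λ w → 𝟙[ w == v ] f e) (if-not (o e))) ⟩
  sumℚ (λ e → 𝟙[ ohead G o e == v ] f e)           ≡⟨ conserved v ⟨
  sumℚ (λ e → 𝟙[ otail G o e == v ] f e)           ≡⟨ sumℚ-cong (λ e → cong (λ w → 𝟙[ w == v ] f e) (if-not (o e))) ⟨
  sumℚ (λ e → 𝟙[ ohead G (reverse o) e == v ] f e) ∎
  where open ≡-Reasoning

𝟙-crossing : ∀ x y c → 𝟙[ x ] c ℚ.+ 𝟙[ not x ∧ y ] c ≡ 𝟙[ y ] c ℚ.+ 𝟙[ x ∧ not y ] c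
𝟙-crossing true  true  c = refl
𝟙-crossing true  false c = ℚ.+-comm c 0ℚ
𝟙-crossing false true  c = ℚ.+-comm 0ℚ c
𝟙-crossing false false c = refl

circulation-cut : ∀ {G o f} → IsCirculation G o f → ∀ (U : Fin (nV G) → Bool) →
  sumℚ (λ e → 𝟙[ U (otail G o e) ∧ not (U (ohead G o e)) ] f e) ≡
  sumℚ (λ e → 𝟙[ not (U (otail G o e)) ∧ U (ohead G o e) ] f e)
circulation-cut {G} {o} {f} conserved U = sym (∙-cancelˡ inside-head entering leaving (begin
  inside-head ℚ.+ entering ≡⟨ cong (ℚ._+ entering) inside-tail≡inside-head ⟨
  inside-tail ℚ.+ entering ≡⟨ sumℚ-distrib-+ (λ e → 𝟙[ U (t e) ] f e) (λ e → 𝟙[ not (U (t e)) ∧ U (h e) ] f e) ⟨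
  sumℚ (λ e → 𝟙[ U (t e) ] f e ℚ.+ 𝟙[ not (U (t e)) ∧ U (h e) ] f e)
                           ≡⟨ sumℚ-cong (λ e → 𝟙-crossing (U (t e)) (U (h e)) (f e)) ⟩
  sumℚ (λ e → 𝟙[ U (h e) ] f e ℚ.+ 𝟙[ U (t e) ∧ not (U (h e)) ] f e)
                           ≡⟨ sumℚ-distrib-+ (λ e → 𝟙[ U (h e) ] f e) (λ e → 𝟙[ U (t e) ∧ not (U (h e)) ] f e) ⟩
  inside-head ℚ.+ leaving  ∎))
  where
  open ≡-Reasoning
  open GroupProperties ℚ.+-0-group using (∙-cancelˡ)
  t h : Fin (nE G) → Fin (nV G)
  t = otail G o
  h = ohead G o
  inside-tail inside-head leaving entering : ℚ
  inside-tail = sumℚ (λ e → 𝟙[ U (t e) ] f e)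
  inside-head = sumℚ (λ e → 𝟙[ U (h e) ] f e)
  leaving  = sumℚ (λ e → 𝟙[ U (t e) ∧ not (U (h e)) ] f e)
  entering = sumℚ (λ e → 𝟙[ not (U (t e)) ∧ U (h e) ] f e)
  inside-tail≡inside-head : inside-tail ≡ inside-head
  inside-tail≡inside-head = begin
    inside-tail                                           ≡⟨ sumℚ-fibres U t f ⟨
    sumℚ (λ v → 𝟙[ U v ] sumℚ (λ e → 𝟙[ t e == v ] f e)) ≡⟨ sumℚ-cong (λ v → cong 𝟙[ U v ]_ (conserved v)) ⟩
    sumℚ (λ v → 𝟙[ U v ] sumℚ (λ e → 𝟙[ h e == v ] f e)) ≡⟨ sumℚ-fibres U h f ⟩
    inside-head                                           ∎

-- the arcs that the flow orientation o traverses from tail to head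
forwardArcs : (D : Digraph) → Orientation (underlying D) → ASet D
forwardArcs D o a = not (o a)

module _ (D : Digraph) (U : VSet D) (o : Orientation (underlying D)) (a : Fin (m D))
         (not-entering : δ⁻ D U a ≡ false) where

  leaves≡forward∧δ⁺ :
    U (otail (underlying D) o a) ∧ not (U (ohead (underlying D) o a)) ≡ forwardArcs D o a ∧ δ⁺ D U a
  leaves≡forward∧δ⁺ with o a
  ... | false = refl
  ... | true  = trans (∧-comm (U (head D a)) (not (U (tail D a)))) not-entering

  enters≡backward∧δ⁺ :
    not (U (otail (underlying D) o a)) ∧ U (ohead (underlying D) o a) ≡ o a ∧ δ⁺ D U a
  enters≡backward∧δ⁺ with o a
  ... | false = not-entering
  ... | true  = ∧-comm (not (U (head D a))) (U (tail D a))

dicut-≤-k*forward : ∀ D (U : VSet D) → (∀ a → δ⁻ D U a ≡ false) →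
  ∀ {k o} {f : Fin (m D) → ℚ} → (∀ a → (1ℚ ≤ f a) × (f a ≤ k - 1ℚ)) →
  IsCirculation (underlying D) o f →
  fromℕ (count (δ⁺ D U)) ≤ k ℚ.* fromℕ (count (λ a → forwardArcs D o a ∧ δ⁺ D U a))
dicut-≤-k*forward D U not-entering {k} {o} {f} bounds conserved = begin
  fromℕ (count C)                    ≡⟨ trans (cong fromℕ (count-split o C)) (fromℕ-+ F B) ⟩
  fromℕ F ℚ.+ fromℕ B                ≤⟨ ℚ.+-monoʳ-≤ (fromℕ F) backward≤ ⟩
  fromℕ F ℚ.+ (k - 1ℚ) ℚ.* fromℕ F   ≡⟨ solve 2 (λ k x → x :+ (k :- con 1ℚ) :* x := k :* x) refl k (fromℕ F) ⟩
  k ℚ.* fromℕ F                      ∎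
  where
  open ℚ.≤-Reasoning
  open ℚSolver.+-*-Solver using (solve; _:+_; _:-_; _:*_; _:=_; con)
  G : Graph
  G = underlying D
  C : ASet D
  C = δ⁺ D U
  F B : ℕ
  F = count (λ a → forwardArcs D o a ∧ C a)
  B = count (λ a → o a ∧ C a)
  backward≤ : fromℕ B ≤ (k - 1ℚ) ℚ.* fromℕ F
  backward≤ = begin
    fromℕ B                                                    ≡⟨ ℚ.*-identityˡ (fromℕ B) ⟨
    1ℚ ℚ.* fromℕ B                                             ≡⟨ sumℚ-𝟙-count (λ a → o a ∧ C a) 1ℚ ⟨
    sumℚ (λ a → 𝟙[ o a ∧ C a ] 1ℚ)                              ≤⟨ sumℚ-mono-≤ (λ a → 𝟙-mono-≤ (o a ∧ C a) (proj₁ (bounds a))) ⟩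
    sumℚ (λ a → 𝟙[ o a ∧ C a ] f a)                             ≡⟨ sumℚ-cong (λ a → cong (λ b → 𝟙[ b ] f a) (enters≡backward∧δ⁺ D U o a (not-entering a))) ⟨
    sumℚ (λ e → 𝟙[ not (U (otail G o e)) ∧ U (ohead G o e) ] f e) ≡⟨ circulation-cut {G} conserved U ⟨
    sumℚ (λ e → 𝟙[ U (otail G o e) ∧ not (U (ohead G o e)) ] f e) ≡⟨ sumℚ-cong (λ a → cong (λ b → 𝟙[ b ] f a) (leaves≡forward∧δ⁺ D U o a (not-entering a))) ⟩
    sumℚ (λ a → 𝟙[ forwardArcs D o a ∧ C a ] f a)               ≤⟨ sumℚ-mono-≤ (λ a → 𝟙-mono-≤ (forwardArcs D o a ∧ C a) (proj₂ (bounds a))) ⟩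
    sumℚ (λ a → 𝟙[ forwardArcs D o a ∧ C a ] (k - 1ℚ))          ≡⟨ sumℚ-𝟙-count (λ a → forwardArcs D o a ∧ C a) (k - 1ℚ) ⟩
    (k - 1ℚ) ℚ.* fromℕ F                                        ∎

reverse-flow : ∀ {G k} → NZCircularFlow G k → NZCircularFlow G k
reverse-flow {G} (o , f , bounds , conserved) = reverse o , f , bounds , circulation-reverse {G} {o} {f} conserved

forwardArcs-isDijoin : ∀ D τ k (2≤k : (+ 2) / 1 ≤ k) → IsMinDicutSize D τ →
  (φ : NZCircularFlow (underlying D) k) → IsDijoin D (floorDiv τ k 2≤k) (forwardArcs D (proj₁ φ))
forwardArcs-isDijoin D τ k 2≤k (_ , τ-min) (o , _ , bounds , conserved)
                     C isDicut@(U , (_ , _ , not-entering) , C≡δ⁺) = begin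
  floorDiv τ k 2≤k                             ≤⟨ floor-≤ (÷-≤ k τ≤k*forward) ⟩
  + count (λ a → forwardArcs D o a ∧ δ⁺ D U a) ≡⟨ cong +_ (count-cong (λ a → cong (forwardArcs D o a ∧_) (C≡δ⁺ a))) ⟨
  + count (λ a → forwardArcs D o a ∧ C a)      ∎
  where
  open ℤ.≤-Reasoning
  instance
    k-positive : Positive k
    k-positive = ℚ.positive (ℚ.<-≤-trans 0<2 2≤k)
  τ≤k*forward : fromℕ τ ≤ k ℚ.* fromℕ (count (λ a → forwardArcs D o a ∧ δ⁺ D U a))
  τ≤k*forward = ℚ.≤-trans (fromℕ-mono-≤ (subst (τ ℕ.≤_) (count-cong C≡δ⁺) (τ-min C isDicut)))
                          (dicut-≤-k*forward D U not-entering {k} {o} bounds conserved)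

proposition1 : (D : Digraph) (τ : ℕ) (k : ℚ) (2≤k : (+ 2) / 1 ≤ k) →
    IsMinDicutSize D τ → NZCircularFlow (underlying D) k →
    ∃ λ (J₁ : ASet D) → ∃ λ (J₂ : ASet D) →
      Disjoint D J₁ J₂ × IsDijoin D (floorDiv τ k 2≤k) J₁ × IsDijoin D (floorDiv τ k 2≤k) J₂
proposition1 D τ k 2≤k τ-min φ@(o , _) =
  forwardArcs D o , forwardArcs D (reverse o) , (λ a → ∧-inverseʳ (not (o a))) ,
  forwardArcs-isDijoin D τ k 2≤k τ-min φ ,
  forwardArcs-isDijoin D τ k 2≤k τ-min (reverse-flow {underlying D} {k} φ)
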